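{- Let $(!,\delta,\varepsilon,\mathsf m,\mathsf m_K)$ be a symmetric monoidal comonad on a symmetric monoidal category $(\mathbb X,\otimes,K)$. Then the following are in bijective correspondence: (1) cocommutative Hopf monoids in $(\mathbb X^!,\otimes^{\mathsf m},(K,\mathsf m_K))$; (2) cocommutative Hopf monoids $(H,\nabla,\mathsf u,\Delta,\mathsf e,\mathsf S)$ in $(\mathbb X,\otimes,K)$ equipped with a natural transformation $\lambda_X:H\otimes!X\to!(H\otimes X)$ such that $\lambda$ is a symmetric monoidal mixed distributive law of $(H\otimes-,\mu^\nabla,\eta^{\mathsf u},\mathsf n^\Delta,\mathsf n^{\mathsf e}_K)$ over $(!,\delta,\varepsilon,\mathsf m,\mathsf m_K)$, $!(\alpha_{H,X,Y})\circ\lambda_{X\otimes Y}\circ(1_H\otimes\mathsf m_{X,Y})=\mathsf m_{H\otimes X,Y}\circ(\lambda_X\otimes1_{!Y})\circ\alpha_{H,!X,!Y}$ for all $X,Y$, and $\lambda_X\circ(\mathsf S\otimes1_{!X})=!(\mathsf S\otimes1_X)\circ\lambda_X$ for all $X$.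
   Context: Composition is written $g\circ f$; $(\mathbb X,\otimes,K)$ is symmetric monoidal with associator $\alpha_{A,B,C}:A\otimes(B\otimes C)\to(A\otimes B)\otimes C$, unitors $\ell,\rho$, symmetry $\sigma$, and interchange iso $\tau_{A,B,C,D}:(A\otimes B)\otimes(C\otimes D)\to(A\otimes C)\otimes(B\otimes D)$. Symmetric monoidal comonad $(!,\delta,\varepsilon,\mathsf m,\mathsf m_K)$: comonad with natural $\mathsf m_{A,B}:!A\otimes!B\to!(A\otimes B)$, $\mathsf m_K:K\to!K$ making $!$ symmetric lax monoidal, with $\delta,\varepsilon$ monoidal transformations. Its Eilenberg–Moore category of coalgebras $\mathbb X^!$ is symmetric monoidal with $(A,\omega)\otimes^{\mathsf m}(B,\omega')=(A\otimes B,\mathsf m_{A,B}\circ(\omega\otimes\omega'))$, unit $(K,\mathsf m_K)$; a cocommutative Hopf monoid in it is a coalgebra $(H,\omega)$ with a cocommutative Hopf monoid structure in $\mathbb X$ all of whose structure maps (including the antipode) are coalgebra morphisms. For a cocommutative bimonoid $(A,\nabla,\mathsf u,\Delta,\mathsf e)$ in $\mathbb X$, $(A\otimes-,\mu^\nabla,\eta^{\mathsf u},\mathsf n^\Delta,\mathsf n^{\mathsf e}_K)$ is the symmetric comonoidal monad with $\mu^\nabla_X=(\nabla\otimes1_X)\circ\alpha_{A,A,X}$, $\eta^{\mathsf u}_X=(\mathsf u\otimes1_X)\circ\ell_X^{ -1}$, $\mathsf n^\Delta_{X,Y}=\tau_{A,A,X,Y}\circ(\Delta\otimes1_{X\otimes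 Y})$, $\mathsf n^{\mathsf e}_K=\mathsf e\circ\rho_A$. For a monad $(\mathsf T,\mu,\eta)$ with comonoidal structure $\mathsf n_{A,B}:\mathsf T(A\otimes B)\to\mathsf TA\otimes\mathsf TB$, $\mathsf n_K:\mathsf TK\to K$, a symmetric monoidal mixed distributive law over $(!,\delta,\varepsilon,\mathsf m,\mathsf m_K)$ is a natural $\lambda_A:\mathsf T!A\to!\mathsf TA$ with $\lambda_A\circ\mu_{!A}=!(\mu_A)\circ\lambda_{\mathsf TA}\circ\mathsf T(\lambda_A)$, $\lambda_A\circ\eta_{!A}=!(\eta_A)$, $\delta_{\mathsf TA}\circ\lambda_A=!(\lambda_A)\circ\lambda_{!A}\circ\mathsf T(\delta_A)$, $\varepsilon_{\mathsf TA}\circ\lambda_A=\mathsf T(\varepsilon_A)$, $!(\mathsf n_{A,B})\circ\lambda_{A\otimes B}\circ\mathsf T(\mathsf m_{A,B})=\mathsf m_{\mathsf TA,\mathsf TB}\circ(\lambda_A\otimes\lambda_B)\circ\mathsf n_{!A,!B}$, $!(\mathsf n_K)\circ\lambda_K\circ\mathsf T(\mathsf m_K)=\mathsf m_K\circ\mathsf n_K$. -}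

module Defs where

open import Level using (Level; _⊔_) renaming (suc to lsuc)
open import Relation.Binary.Structures using (IsEquivalence)
open import Relation.Binary.Bundles using (Setoid)

record Category (o h e : Level) : Set (lsuc (o ⊔ h ⊔ e)) where
  infixr 9 _∘_
  infix  4 _≈_
  field
    Obj  : Set o
    _⇒_  : Obj → Obj → Set h
    _≈_  : ∀ {A B} → A ⇒ B → A ⇒ B → Set e
    id   : ∀ {A} → A ⇒ A
    _∘_  : ∀ {A B C} → B ⇒ C → A ⇒ B → A ⇒ C
    equiv     : ∀ {A B} → IsEquivalence (_≈_ {A} {B})
    assoc     : ∀ {A B C D} {f : A ⇒ B} {g : B ⇒ C} {h : C ⇒ D} →
                (h ∘ g) ∘ f ≈ h ∘ (g ∘ f)
    identityˡ : ∀ {A B} {f : A ⇒ B} → id ∘ f ≈ f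
    identityʳ : ∀ {A B} {f : A ⇒ B} → f ∘ id ≈ f
    ∘-resp-≈  : ∀ {A B C} {f f' : B ⇒ C} {g g' : A ⇒ B} →
                f ≈ f' → g ≈ g' → f ∘ g ≈ f' ∘ g'

record SymMonCat (o h e : Level) : Set (lsuc (o ⊔ h ⊔ e)) where
  field
    cat : Category o h e
  open Category cat public
  infixr 10 _⊗₀_ _⊗₁_
  field
    _⊗₀_ : Obj → Obj → Obj
    _⊗₁_ : ∀ {A B C D} → A ⇒ B → C ⇒ D → (A ⊗₀ C) ⇒ (B ⊗₀ D)
    ⊗-identity : ∀ {A B} → id {A} ⊗₁ id {B} ≈ id
    ⊗-homomorphism : ∀ {A B C A' B' C'} {f : A ⇒ B} {g : B ⇒ C}
                       {f' : A' ⇒ B'} {g' : B' ⇒ C'} →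
                     (g ∘ f) ⊗₁ (g' ∘ f') ≈ (g ⊗₁ g') ∘ (f ⊗₁ f')
    ⊗-resp-≈ : ∀ {A B C D} {f f' : A ⇒ B} {g g' : C ⇒ D} →
               f ≈ f' → g ≈ g' → f ⊗₁ g ≈ f' ⊗₁ g'
    K : Obj
    α    : ∀ A B C → (A ⊗₀ (B ⊗₀ C)) ⇒ ((A ⊗₀ B) ⊗₀ C)
    α⁻¹  : ∀ A B C → ((A ⊗₀ B) ⊗₀ C) ⇒ (A ⊗₀ (B ⊗₀ C))
    α-isoˡ : ∀ {A B C} → α⁻¹ A B C ∘ α A B C ≈ id
    α-isoʳ : ∀ {A B C} → α A B C ∘ α⁻¹ A B C ≈ id
    α-natural : ∀ {A A' B B' C C'} {f : A ⇒ A'} {g : B ⇒ B'} {h : C ⇒ C'} →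
                α A' B' C' ∘ (f ⊗₁ (g ⊗₁ h)) ≈ ((f ⊗₁ g) ⊗₁ h) ∘ α A B C
    ℓ    : ∀ A → (K ⊗₀ A) ⇒ A
    ℓ⁻¹  : ∀ A → A ⇒ (K ⊗₀ A)
    ℓ-isoˡ : ∀ {A} → ℓ⁻¹ A ∘ ℓ A ≈ id
    ℓ-isoʳ : ∀ {A} → ℓ A ∘ ℓ⁻¹ A ≈ id
    ℓ-natural : ∀ {A B} {f : A ⇒ B} → ℓ B ∘ (id ⊗₁ f) ≈ f ∘ ℓ A
    ρ    : ∀ A → (A ⊗₀ K) ⇒ A
    ρ⁻¹  : ∀ A → A ⇒ (A ⊗₀ K)
    ρ-isoˡ : ∀ {A} → ρ⁻¹ A ∘ ρ A ≈ id
    ρ-isoʳ : ∀ {A} → ρ A ∘ ρ⁻¹ A ≈ id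
    ρ-natural : ∀ {A B} {f : A ⇒ B} → ρ B ∘ (f ⊗₁ id) ≈ f ∘ ρ A
    pentagon : ∀ {A B C D} →
      α (A ⊗₀ B) C D ∘ α A B (C ⊗₀ D)
        ≈ (α A B C ⊗₁ id) ∘ (α A (B ⊗₀ C) D ∘ (id ⊗₁ α B C D))
    triangle : ∀ {A B} → (ρ A ⊗₁ id {B}) ∘ α A K B ≈ id {A} ⊗₁ ℓ B
    σ : ∀ A B → (A ⊗₀ B) ⇒ (B ⊗₀ A)
    σ-natural : ∀ {A A' B B'} {f : A ⇒ A'} {g : B ⇒ B'} →
                σ A' B' ∘ (f ⊗₁ g) ≈ (g ⊗₁ f) ∘ σ A B
    σ-involutive : ∀ {A B} → σ B A ∘ σ A B ≈ id
    hexagon : ∀ {A B C} →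
      α⁻¹ B C A ∘ (σ A (B ⊗₀ C) ∘ α⁻¹ A B C)
        ≈ (id ⊗₁ σ A C) ∘ (α⁻¹ B A C ∘ (σ A B ⊗₁ id))

  τ : ∀ A B C D → ((A ⊗₀ B) ⊗₀ (C ⊗₀ D)) ⇒ ((A ⊗₀ C) ⊗₀ (B ⊗₀ D))
  τ A B C D =
    α A C (B ⊗₀ D) ∘ ((id ⊗₁ α⁻¹ C B D) ∘ ((id ⊗₁ (σ B C ⊗₁ id)) ∘
      ((id ⊗₁ α B C D) ∘ α⁻¹ A B (C ⊗₀ D))))

record SymMonComonad {o h e} (𝕏 : SymMonCat o h e) : Set (o ⊔ h ⊔ e) where
  open SymMonCat 𝕏
  field
    !₀ : Obj → Obj
    !₁ : ∀ {A B} → A ⇒ B → !₀ A ⇒ !₀ B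
    !-identity : ∀ {A} → !₁ (id {A}) ≈ id
    !-homomorphism : ∀ {A B C} {f : A ⇒ B} {g : B ⇒ C} →
                     !₁ (g ∘ f) ≈ !₁ g ∘ !₁ f
    !-resp-≈ : ∀ {A B} {f g : A ⇒ B} → f ≈ g → !₁ f ≈ !₁ g
    δ : ∀ A → !₀ A ⇒ !₀ (!₀ A)
    ε : ∀ A → !₀ A ⇒ A
    δ-natural : ∀ {A B} {f : A ⇒ B} → δ B ∘ !₁ f ≈ !₁ (!₁ f) ∘ δ A
    ε-natural : ∀ {A B} {f : A ⇒ B} → ε B ∘ !₁ f ≈ f ∘ ε A
    counitˡ : ∀ {A} → ε (!₀ A) ∘ δ A ≈ id
    counitʳ : ∀ {A} → !₁ (ε A) ∘ δ A ≈ id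
    coassoc : ∀ {A} → δ (!₀ A) ∘ δ A ≈ !₁ (δ A) ∘ δ A
    m  : ∀ A B → (!₀ A ⊗₀ !₀ B) ⇒ !₀ (A ⊗₀ B)
    mK : K ⇒ !₀ K
    m-natural : ∀ {A A' B B'} {f : A ⇒ A'} {g : B ⇒ B'} →
                m A' B' ∘ (!₁ f ⊗₁ !₁ g) ≈ !₁ (f ⊗₁ g) ∘ m A B
    m-assoc : ∀ {A B C} →
      !₁ (α A B C) ∘ (m A (B ⊗₀ C) ∘ (id ⊗₁ m B C))
        ≈ m (A ⊗₀ B) C ∘ ((m A B ⊗₁ id) ∘ α (!₀ A) (!₀ B) (!₀ C))
    m-unitˡ : ∀ {A} → !₁ (ℓ A) ∘ (m K A ∘ (mK ⊗₁ id)) ≈ ℓ (!₀ A)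
    m-unitʳ : ∀ {A} → !₁ (ρ A) ∘ (m A K ∘ (id ⊗₁ mK)) ≈ ρ (!₀ A)
    m-symmetric : ∀ {A B} → !₁ (σ A B) ∘ m A B ≈ m B A ∘ σ (!₀ A) (!₀ B)
    δ-monoidal : ∀ {A B} →
      δ (A ⊗₀ B) ∘ m A B ≈ !₁ (m A B) ∘ (m (!₀ A) (!₀ B) ∘ (δ A ⊗₁ δ B))
    δ-monoidal-K : δ K ∘ mK ≈ !₁ mK ∘ mK
    ε-monoidal : ∀ {A B} → ε (A ⊗₀ B) ∘ m A B ≈ ε A ⊗₁ ε B
    ε-monoidal-K : ε K ∘ mK ≈ id

module Structures {o h e} (𝕏 : SymMonCat o h e) (C : SymMonComonad 𝕏) where
  open SymMonCat 𝕏
  open SymMonComonad C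
  module E {A B : Obj} = IsEquivalence (equiv {A} {B})

  record HopfData (H : Obj) : Set h where
    field
      ∇ : (H ⊗₀ H) ⇒ H
      u : K ⇒ H
      Δ : H ⇒ (H ⊗₀ H)
      ẽ : H ⇒ K
      S : H ⇒ H

  record IsCocommHopf {H : Obj} (d : HopfData H) : Set e where
    open HopfData d
    field
      ∇-assoc   : ∇ ∘ ((∇ ⊗₁ id) ∘ α H H H) ≈ ∇ ∘ (id ⊗₁ ∇)
      ∇-unitˡ   : ∇ ∘ (u ⊗₁ id) ≈ ℓ H
      ∇-unitʳ   : ∇ ∘ (id ⊗₁ u) ≈ ρ H
      Δ-coassoc : α H H H ∘ ((id ⊗₁ Δ) ∘ Δ) ≈ (Δ ⊗₁ id) ∘ Δ
      Δ-counitˡ : ℓ H ∘ ((ẽ ⊗₁ id) ∘ Δ) ≈ id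
      Δ-counitʳ : ρ H ∘ ((id ⊗₁ ẽ) ∘ Δ) ≈ id
      bi-Δ∇     : Δ ∘ ∇ ≈ (∇ ⊗₁ ∇) ∘ (τ H H H H ∘ (Δ ⊗₁ Δ))
      bi-ẽ∇     : ẽ ∘ ∇ ≈ ρ K ∘ (ẽ ⊗₁ ẽ)
      bi-Δu     : Δ ∘ u ≈ (u ⊗₁ u) ∘ ρ⁻¹ K
      bi-ẽu     : ẽ ∘ u ≈ id
      antipodeˡ : ∇ ∘ ((S ⊗₁ id) ∘ Δ) ≈ u ∘ ẽ
      antipodeʳ : ∇ ∘ ((id ⊗₁ S) ∘ Δ) ≈ u ∘ ẽ
      cocommutative : σ H H ∘ Δ ≈ Δ

  record IsCoalgebra {A : Obj} (ω : A ⇒ !₀ A) : Set e where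
    field
      coalg-counit : ε A ∘ ω ≈ id
      coalg-coassoc : δ A ∘ ω ≈ !₁ ω ∘ ω

  -- (1) cocommutative Hopf monoid in (𝕏^!, ⊗^m, (K, mK)) with carrier H
  record HopfInCoalg (H : Obj) : Set (h ⊔ e) where
    field
      ω : H ⇒ !₀ H
      isCoalgebra : IsCoalgebra ω
      hopf : HopfData H
      isHopf : IsCocommHopf hopf
    open HopfData hopf
    field
      ∇-coalg : ω ∘ ∇ ≈ !₁ ∇ ∘ (m H H ∘ (ω ⊗₁ ω))
      u-coalg : ω ∘ u ≈ !₁ u ∘ mK
      Δ-coalg : (m H H ∘ (ω ⊗₁ ω)) ∘ Δ ≈ !₁ Δ ∘ ω
      ẽ-coalg : mK ∘ ẽ ≈ !₁ ẽ ∘ ω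
      S-coalg : ω ∘ S ≈ !₁ S ∘ ω

  module TMonad {H : Obj} (d : HopfData H) where
    open HopfData d
    T₀ : Obj → Obj
    T₀ X = H ⊗₀ X
    T₁ : ∀ {X Y} → X ⇒ Y → T₀ X ⇒ T₀ Y
    T₁ f = id ⊗₁ f
    μ : ∀ X → T₀ (T₀ X) ⇒ T₀ X
    μ X = (∇ ⊗₁ id) ∘ α H H X
    η : ∀ X → X ⇒ T₀ X
    η X = (u ⊗₁ id) ∘ ℓ⁻¹ X
    n : ∀ X Y → T₀ (X ⊗₀ Y) ⇒ (T₀ X ⊗₀ T₀ Y)
    n X Y = τ H H X Y ∘ (Δ ⊗₁ id)
    nK : T₀ K ⇒ K
    nK = ẽ ∘ ρ H

  record IsSymMonMixedDistLaw {H : Obj} (d : HopfData H)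
           (λ' : ∀ X → (H ⊗₀ !₀ X) ⇒ !₀ (H ⊗₀ X)) : Set (o ⊔ h ⊔ e) where
    open TMonad d
    field
      natural : ∀ {X Y} {f : X ⇒ Y} → λ' Y ∘ T₁ (!₁ f) ≈ !₁ (T₁ f) ∘ λ' X
      law-μ : ∀ {X} → λ' X ∘ μ (!₀ X) ≈ !₁ (μ X) ∘ (λ' (T₀ X) ∘ T₁ (λ' X))
      law-η : ∀ {X} → λ' X ∘ η (!₀ X) ≈ !₁ (η X)
      law-δ : ∀ {X} → δ (T₀ X) ∘ λ' X ≈ !₁ (λ' X) ∘ (λ' (!₀ X) ∘ T₁ (δ X))
      law-ε : ∀ {X} → ε (T₀ X) ∘ λ' X ≈ T₁ (ε X)
      law-m : ∀ {X Y} →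
        !₁ (n X Y) ∘ (λ' (X ⊗₀ Y) ∘ T₁ (m X Y))
          ≈ m (T₀ X) (T₀ Y) ∘ ((λ' X ⊗₁ λ' Y) ∘ n (!₀ X) (!₀ Y))
      law-mK : !₁ nK ∘ (λ' K ∘ T₁ mK) ≈ mK ∘ nK

  record HopfWithLaw (H : Obj) : Set (o ⊔ h ⊔ e) where
    field
      hopf : HopfData H
      isHopf : IsCocommHopf hopf
      lam : ∀ X → (H ⊗₀ !₀ X) ⇒ !₀ (H ⊗₀ X)
      isDistLaw : IsSymMonMixedDistLaw hopf lam
    open HopfData hopf
    field
      lam-α : ∀ {X Y} →
        !₁ (α H X Y) ∘ (lam (X ⊗₀ Y) ∘ (id ⊗₁ m X Y))
          ≈ m (H ⊗₀ X) Y ∘ ((lam X ⊗₁ id) ∘ α H (!₀ X) (!₀ Y))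
      lam-S : ∀ {X} → lam X ∘ (S ⊗₁ id) ≈ !₁ (S ⊗₁ id) ∘ lam X

  record _≈H_ {H : Obj} (d d' : HopfData H) : Set e where
    private
      module d = HopfData d
      module d' = HopfData d'
    field
      ∇≈ : d.∇ ≈ d'.∇
      u≈ : d.u ≈ d'.u
      Δ≈ : d.Δ ≈ d'.Δ
      ẽ≈ : d.ẽ ≈ d'.ẽ
      S≈ : d.S ≈ d'.S

  ≈H-refl : ∀ {H} {d : HopfData H} → d ≈H d
  ≈H-refl = record { ∇≈ = E.refl ; u≈ = E.refl ; Δ≈ = E.refl ; ẽ≈ = E.refl ; S≈ = E.refl }

  ≈H-sym : ∀ {H} {d d' : HopfData H} → d ≈H d' → d' ≈H d
  ≈H-sym p = record { ∇≈ = E.sym ∇≈ ; u≈ = E.sym u≈ ; Δ≈ = E.sym Δ≈ ; ẽ≈ = E.sym ẽ≈ ; S≈ = E.sym S≈ }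
    where open _≈H_ p

  ≈H-trans : ∀ {H} {d d' d'' : HopfData H} → d ≈H d' → d' ≈H d'' → d ≈H d''
  ≈H-trans p q = record
    { ∇≈ = E.trans (_≈H_.∇≈ p) (_≈H_.∇≈ q) ; u≈ = E.trans (_≈H_.u≈ p) (_≈H_.u≈ q)
    ; Δ≈ = E.trans (_≈H_.Δ≈ p) (_≈H_.Δ≈ q) ; ẽ≈ = E.trans (_≈H_.ẽ≈ p) (_≈H_.ẽ≈ q)
    ; S≈ = E.trans (_≈H_.S≈ p) (_≈H_.S≈ q) }

  record _≈₁_ {H : Obj} (x y : HopfInCoalg H) : Set e where
    field
      ω≈ : HopfInCoalg.ω x ≈ HopfInCoalg.ω y
      hopf≈ : HopfInCoalg.hopf x ≈H HopfInCoalg.hopf y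

  record _≈₂_ {H : Obj} (x y : HopfWithLaw H) : Set (o ⊔ e) where
    field
      hopf≈ : HopfWithLaw.hopf x ≈H HopfWithLaw.hopf y
      lam≈ : ∀ X → HopfWithLaw.lam x X ≈ HopfWithLaw.lam y X

  HopfInCoalg-setoid : Obj → Setoid (h ⊔ e) e
  HopfInCoalg-setoid H = record
    { Carrier = HopfInCoalg H
    ; _≈_ = _≈₁_
    ; isEquivalence = record
      { refl = record { ω≈ = E.refl ; hopf≈ = ≈H-refl }
      ; sym = λ p → record { ω≈ = E.sym (_≈₁_.ω≈ p) ; hopf≈ = ≈H-sym (_≈₁_.hopf≈ p) }
      ; trans = λ p q → record { ω≈ = E.trans (_≈₁_.ω≈ p) (_≈₁_.ω≈ q)
                               ; hopf≈ = ≈H-trans (_≈₁_.hopf≈ p) (_≈₁_.hopf≈ q) }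
      }
    }

  HopfWithLaw-setoid : Obj → Setoid (o ⊔ h ⊔ e) (o ⊔ e)
  HopfWithLaw-setoid H = record
    { Carrier = HopfWithLaw H
    ; _≈_ = _≈₂_
    ; isEquivalence = record
      { refl = record { hopf≈ = ≈H-refl ; lam≈ = λ _ → E.refl }
      ; sym = λ p → record { hopf≈ = ≈H-sym (_≈₂_.hopf≈ p) ; lam≈ = λ X → E.sym (_≈₂_.lam≈ p X) }
      ; trans = λ p q → record { hopf≈ = ≈H-trans (_≈₂_.hopf≈ p) (_≈₂_.hopf≈ q)
                               ; lam≈ = λ X → E.trans (_≈₂_.lam≈ p X) (_≈₂_.lam≈ q X) }
      }
    }

-- A coaction ω : H → !H and a family λ_X : H ⊗ !X → !(H ⊗ X) determine each other through
-- λ_X = m_{H,X} ∘ (ω ⊗ 1) and ω = !ρ ∘ λ_K ∘ (1 ⊗ m_K) ∘ ρ⁻¹: the second formula recovers ω from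
-- the first by the right unit law of m, and naturality together with the compatibility with α
-- forces every λ to be of the first form. Under this correspondence each axiom of a symmetric
-- monoidal mixed distributive law amounts to one condition on ω: the ε- and δ-axioms to the
-- coalgebra laws, the μ-, η-, n- and n_K-axioms to ∇, u, Δ and e being coalgebra morphisms, and
-- the compatibility with S to S being one. The converse implications are read off at X = K,
-- where g ↦ m ∘ (g ⊗ 1) is injective thanks to m_K and the unit law of m.
module Submission where

open import Level using (_⊔_)
open import Defs
open import Function.Bundles using (Inverse)
open import Relation.Binary.Bundles using (Setoid)
open import Data.Product using (_,_)
import Relation.Binary.Reasoning.Setoid as SetoidReasoning

module SymMonCatProperties {o h e} (𝕏 : SymMonCat o h e) where
  open SymMonCat 𝕏

  hom-setoid : Obj → Obj → Setoid h e
  hom-setoid A B = record { Carrier = A ⇒ B ; _≈_ = _≈_ ; isEquivalence = equiv }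

  module HomReasoning {A B : Obj} = SetoidReasoning (hom-setoid A B)
  open HomReasoning

  module HomEquiv {A B : Obj} = Setoid (hom-setoid A B)
  open HomEquiv public using () renaming (refl to ≈refl; sym to ≈sym; trans to ≈trans)

  infixr 4 _⟩∘⟨_
  _⟩∘⟨_ : ∀ {A B C} {f f' : B ⇒ C} {g g' : A ⇒ B} → f ≈ f' → g ≈ g' → f ∘ g ≈ f' ∘ g'
  _⟩∘⟨_ = ∘-resp-≈

  refl⟩∘⟨_ : ∀ {A B C} {f : B ⇒ C} {g g' : A ⇒ B} → g ≈ g' → f ∘ g ≈ f ∘ g'
  refl⟩∘⟨ p = ∘-resp-≈ ≈refl p

  _⟩∘⟨refl : ∀ {A B C} {f f' : B ⇒ C} {g : A ⇒ B} → f ≈ f' → f ∘ g ≈ f' ∘ g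
  p ⟩∘⟨refl = ∘-resp-≈ p ≈refl

  sym-assoc : ∀ {A B C D} {f : A ⇒ B} {g : B ⇒ C} {h : C ⇒ D} → h ∘ (g ∘ f) ≈ (h ∘ g) ∘ f
  sym-assoc = ≈sym assoc

  pullˡ : ∀ {A B C D} {a : C ⇒ D} {b : B ⇒ C} {c : B ⇒ D} {f : A ⇒ B} →
          a ∘ b ≈ c → a ∘ (b ∘ f) ≈ c ∘ f
  pullˡ p = ≈trans sym-assoc (p ⟩∘⟨refl)

  pullʳ : ∀ {A B C D} {a : C ⇒ D} {b : B ⇒ C} {c : A ⇒ C} {f : A ⇒ B} →
          b ∘ f ≈ c → (a ∘ b) ∘ f ≈ a ∘ c
  pullʳ p = ≈trans assoc (refl⟩∘⟨ p)

  pushˡ : ∀ {A B C D} {a : C ⇒ D} {b : B ⇒ C} {c : B ⇒ D} {f : A ⇒ B} →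
          c ≈ a ∘ b → c ∘ f ≈ a ∘ (b ∘ f)
  pushˡ p = ≈trans (p ⟩∘⟨refl) assoc

  cancelˡ : ∀ {A B C} {x : B ⇒ A} {y : A ⇒ B} {z : C ⇒ A} → x ∘ y ≈ id → x ∘ (y ∘ z) ≈ z
  cancelˡ p = ≈trans (pullˡ p) identityˡ

  cancelʳ : ∀ {A B C} {x : B ⇒ A} {y : A ⇒ B} {z : A ⇒ C} → x ∘ y ≈ id → (z ∘ x) ∘ y ≈ z
  cancelʳ p = ≈trans (pullʳ p) identityʳ

  section-cancelˡ : ∀ {A B C} {g : B ⇒ C} {r : C ⇒ B} {a b : A ⇒ B} →
                    r ∘ g ≈ id → g ∘ a ≈ g ∘ b → a ≈ b
  section-cancelˡ {g = g} {r} {a} {b} p q = begin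
    a            ≈⟨ ≈sym (cancelˡ p) ⟩
    r ∘ (g ∘ a)  ≈⟨ refl⟩∘⟨ q ⟩
    r ∘ (g ∘ b)  ≈⟨ cancelˡ p ⟩
    b            ∎

  retraction-cancelʳ : ∀ {A B C} {g : A ⇒ B} {s : B ⇒ A} {a b : B ⇒ C} →
                       g ∘ s ≈ id → a ∘ g ≈ b ∘ g → a ≈ b
  retraction-cancelʳ {g = g} {s} {a} {b} p q = begin
    a            ≈⟨ ≈sym (cancelʳ p) ⟩
    (a ∘ g) ∘ s  ≈⟨ q ⟩∘⟨refl ⟩
    (b ∘ g) ∘ s  ≈⟨ cancelʳ p ⟩
    b            ∎

  square-invert : ∀ {A B C D} {f : B ⇒ D} {f⁻¹ : D ⇒ B} {k : A ⇒ C} {k⁻¹ : C ⇒ A}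
                    {a : A ⇒ B} {b : C ⇒ D} →
                  f⁻¹ ∘ f ≈ id → k ∘ k⁻¹ ≈ id → f ∘ a ≈ b ∘ k → a ∘ k⁻¹ ≈ f⁻¹ ∘ b
  square-invert {f = f} {f⁻¹} {k} {k⁻¹} {a} {b} p q r = begin
    a ∘ k⁻¹                ≈⟨ ≈sym (cancelˡ p) ⟩
    f⁻¹ ∘ (f ∘ (a ∘ k⁻¹))  ≈⟨ refl⟩∘⟨ pullˡ r ⟩
    f⁻¹ ∘ ((b ∘ k) ∘ k⁻¹)  ≈⟨ refl⟩∘⟨ cancelʳ q ⟩
    f⁻¹ ∘ b                ∎

  paste : ∀ {X₀ X₁ X₂ Y₀ Y₁ Y₂} {f : X₀ ⇒ X₁} {f' : X₁ ⇒ X₂} {a : Y₀ ⇒ X₀} {b : Y₁ ⇒ X₁}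
            {c : Y₂ ⇒ X₂} {g : Y₀ ⇒ Y₁} {g' : Y₁ ⇒ Y₂} →
          f ∘ a ≈ b ∘ g → f' ∘ b ≈ c ∘ g' → (f' ∘ f) ∘ a ≈ c ∘ (g' ∘ g)
  paste p q = ≈trans (pullʳ p) (≈trans sym-assoc (≈trans (q ⟩∘⟨refl) assoc))

  ⊗-∘ : ∀ {A B C A' B' C'} {f : B ⇒ C} {g : A ⇒ B} {f' : B' ⇒ C'} {g' : A' ⇒ B'} →
        (f ⊗₁ f') ∘ (g ⊗₁ g') ≈ (f ∘ g) ⊗₁ (f' ∘ g')
  ⊗-∘ = ≈sym ⊗-homomorphism

  ⊗-split₁₂ : ∀ {A B C D} {f : A ⇒ B} {g : C ⇒ D} → f ⊗₁ g ≈ (f ⊗₁ id) ∘ (id ⊗₁ g)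
  ⊗-split₁₂ = ≈trans (⊗-resp-≈ (≈sym identityʳ) (≈sym identityˡ)) ⊗-homomorphism

  ⊗-split₂₁ : ∀ {A B C D} {f : A ⇒ B} {g : C ⇒ D} → f ⊗₁ g ≈ (id ⊗₁ g) ∘ (f ⊗₁ id)
  ⊗-split₂₁ = ≈trans (⊗-resp-≈ (≈sym identityˡ) (≈sym identityʳ)) ⊗-homomorphism

  ⊗-commute : ∀ {A B C D} {f : A ⇒ B} {g : C ⇒ D} → (f ⊗₁ id) ∘ (id ⊗₁ g) ≈ (id ⊗₁ g) ∘ (f ⊗₁ id)
  ⊗-commute = ≈trans (≈sym ⊗-split₁₂) ⊗-split₂₁

  ⊗id-resp-≈ : ∀ {A B C} {f f' : A ⇒ B} → f ≈ f' → f ⊗₁ id {C} ≈ f' ⊗₁ id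
  ⊗id-resp-≈ p = ⊗-resp-≈ p ≈refl

  id⊗-resp-≈ : ∀ {A B C} {f f' : A ⇒ B} → f ≈ f' → id {C} ⊗₁ f ≈ id ⊗₁ f'
  id⊗-resp-≈ p = ⊗-resp-≈ ≈refl p

  id⊗-∘ : ∀ {A B C D} {f : B ⇒ C} {g : A ⇒ B} → (id {D} ⊗₁ f) ∘ (id ⊗₁ g) ≈ id ⊗₁ (f ∘ g)
  id⊗-∘ = ≈trans ⊗-∘ (⊗-resp-≈ identityˡ ≈refl)

  ⊗id-∘ : ∀ {A B C D} {f : B ⇒ C} {g : A ⇒ B} → (f ⊗₁ id {D}) ∘ (g ⊗₁ id) ≈ (f ∘ g) ⊗₁ id
  ⊗id-∘ = ≈trans ⊗-∘ (⊗-resp-≈ ≈refl identityˡ)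

  id⊗-inverse : ∀ {A B C} {f : A ⇒ B} {g : B ⇒ A} → f ∘ g ≈ id → (id {C} ⊗₁ f) ∘ (id ⊗₁ g) ≈ id
  id⊗-inverse p = ≈trans id⊗-∘ (≈trans (id⊗-resp-≈ p) ⊗-identity)

  ⊗id-inverse : ∀ {A B C} {f : A ⇒ B} {g : B ⇒ A} → f ∘ g ≈ id → (f ⊗₁ id {C}) ∘ (g ⊗₁ id) ≈ id
  ⊗id-inverse p = ≈trans ⊗id-∘ (≈trans (⊗id-resp-≈ p) ⊗-identity)

  id⊗-square : ∀ {X X' Y Y' P Q} {f : X ⇒ X'} {g : Y ⇒ X} {g' : Y' ⇒ X'} {f' : Y ⇒ Y'} {a : P ⇒ Q} →
               f ∘ g ≈ g' ∘ f' → (id ⊗₁ f) ∘ (a ⊗₁ g) ≈ (a ⊗₁ g') ∘ (id ⊗₁ f')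
  id⊗-square p = ≈trans ⊗-∘ (≈trans (⊗-resp-≈ (≈trans identityˡ (≈sym identityʳ)) p) ⊗-homomorphism)

  ⊗id-square : ∀ {X X' Y Y' P Q} {f : X ⇒ X'} {g : Y ⇒ X} {g' : Y' ⇒ X'} {f' : Y ⇒ Y'} {a : P ⇒ Q} →
               f ∘ g ≈ g' ∘ f' → (f ⊗₁ id) ∘ (g ⊗₁ a) ≈ (g' ⊗₁ a) ∘ (f' ⊗₁ id)
  ⊗id-square p = ≈trans ⊗-∘ (≈trans (⊗-resp-≈ p (≈trans identityˡ (≈sym identityʳ))) ⊗-homomorphism)

  α⁻¹-natural : ∀ {A A' B B' C C'} {f : A ⇒ A'} {g : B ⇒ B'} {h : C ⇒ C'} →
                α⁻¹ A' B' C' ∘ ((f ⊗₁ g) ⊗₁ h) ≈ (f ⊗₁ (g ⊗₁ h)) ∘ α⁻¹ A B C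
  α⁻¹-natural = ≈sym (square-invert α-isoˡ α-isoʳ α-natural)

  ρ⁻¹-natural : ∀ {A B} {f : A ⇒ B} → ρ⁻¹ B ∘ f ≈ (f ⊗₁ id) ∘ ρ⁻¹ A
  ρ⁻¹-natural = ≈sym (square-invert ρ-isoˡ ρ-isoʳ ρ-natural)

  triangle⁻¹ : ∀ {A B} → ρ⁻¹ A ⊗₁ id {B} ≈ α A K B ∘ (id ⊗₁ ℓ⁻¹ B)
  triangle⁻¹ {A} {B} = begin
    ρ⁻¹ A ⊗₁ id
      ≈⟨ ≈sym (≈trans (refl⟩∘⟨ id⊗-inverse ℓ-isoʳ) identityʳ) ⟩
    (ρ⁻¹ A ⊗₁ id) ∘ ((id ⊗₁ ℓ B) ∘ (id ⊗₁ ℓ⁻¹ B))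
      ≈⟨ refl⟩∘⟨ (≈sym triangle ⟩∘⟨refl) ⟩
    (ρ⁻¹ A ⊗₁ id) ∘ (((ρ A ⊗₁ id) ∘ α A K B) ∘ (id ⊗₁ ℓ⁻¹ B))
      ≈⟨ refl⟩∘⟨ assoc ⟩
    (ρ⁻¹ A ⊗₁ id) ∘ ((ρ A ⊗₁ id) ∘ (α A K B ∘ (id ⊗₁ ℓ⁻¹ B)))
      ≈⟨ cancelˡ (⊗id-inverse ρ-isoˡ) ⟩
    α A K B ∘ (id ⊗₁ ℓ⁻¹ B) ∎

  τ-natural : ∀ {A B C D A' B' C' D'} {a : A ⇒ A'} {b : B ⇒ B'} {c : C ⇒ C'} {d : D ⇒ D'} →
              τ A' B' C' D' ∘ ((a ⊗₁ b) ⊗₁ (c ⊗₁ d)) ≈ ((a ⊗₁ c) ⊗₁ (b ⊗₁ d)) ∘ τ A B C D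
  τ-natural = paste (paste (paste (paste α⁻¹-natural (id⊗-square α-natural))
                                  (id⊗-square (⊗id-square σ-natural)))
                           (id⊗-square α⁻¹-natural))
                    α-natural

  τ-involutive : ∀ {A B C D} → τ A C B D ∘ τ A B C D ≈ id
  τ-involutive {A} {B} {C} {D} = begin
    (α A B (C ⊗₀ D) ∘ (a⁻¹ ∘ (s ∘ (a ∘ α⁻¹ A C (B ⊗₀ D))))) ∘ τ A B C D
      ≈⟨ ≈trans assoc (refl⟩∘⟨ ≈trans assoc (refl⟩∘⟨ ≈trans assoc (refl⟩∘⟨ assoc))) ⟩
    α A B (C ⊗₀ D) ∘ (a⁻¹ ∘ (s ∘ (a ∘ (α⁻¹ A C (B ⊗₀ D) ∘ τ A B C D))))
      ≈⟨ refl⟩∘⟨ refl⟩∘⟨ refl⟩∘⟨ refl⟩∘⟨ cancelˡ α-isoˡ ⟩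
    α A B (C ⊗₀ D) ∘ (a⁻¹ ∘ (s ∘ (a ∘ ((id ⊗₁ α⁻¹ C B D) ∘ ((id ⊗₁ (σ B C ⊗₁ id)) ∘ rest)))))
      ≈⟨ refl⟩∘⟨ refl⟩∘⟨ refl⟩∘⟨ cancelˡ (id⊗-inverse α-isoʳ) ⟩
    α A B (C ⊗₀ D) ∘ (a⁻¹ ∘ (s ∘ ((id ⊗₁ (σ B C ⊗₁ id)) ∘ rest)))
      ≈⟨ refl⟩∘⟨ refl⟩∘⟨ cancelˡ (id⊗-inverse (⊗id-inverse σ-involutive)) ⟩
    α A B (C ⊗₀ D) ∘ (a⁻¹ ∘ ((id ⊗₁ α B C D) ∘ α⁻¹ A B (C ⊗₀ D)))
      ≈⟨ refl⟩∘⟨ cancelˡ (id⊗-inverse α-isoˡ) ⟩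
    α A B (C ⊗₀ D) ∘ α⁻¹ A B (C ⊗₀ D)
      ≈⟨ α-isoʳ ⟩
    id ∎
    where
      a⁻¹ : (A ⊗₀ ((B ⊗₀ C) ⊗₀ D)) ⇒ (A ⊗₀ (B ⊗₀ (C ⊗₀ D)))
      a⁻¹ = id ⊗₁ α⁻¹ B C D
      s : (A ⊗₀ ((C ⊗₀ B) ⊗₀ D)) ⇒ (A ⊗₀ ((B ⊗₀ C) ⊗₀ D))
      s = id ⊗₁ (σ C B ⊗₁ id)
      a : (A ⊗₀ (C ⊗₀ (B ⊗₀ D))) ⇒ (A ⊗₀ ((C ⊗₀ B) ⊗₀ D))
      a = id ⊗₁ α C B D
      rest : ((A ⊗₀ B) ⊗₀ (C ⊗₀ D)) ⇒ (A ⊗₀ ((B ⊗₀ C) ⊗₀ D))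
      rest = (id ⊗₁ α B C D) ∘ α⁻¹ A B (C ⊗₀ D)

module SymMonComonadProperties {o h e} (𝕏 : SymMonCat o h e) (C : SymMonComonad 𝕏) where
  open SymMonCat 𝕏
  open SymMonComonad C
  open SymMonCatProperties 𝕏
  open HomReasoning

  !-inverse : ∀ {A B} {f : A ⇒ B} {g : B ⇒ A} → g ∘ f ≈ id → !₁ g ∘ !₁ f ≈ id
  !-inverse p = ≈trans (≈sym !-homomorphism) (≈trans (!-resp-≈ p) !-identity)

  !-square : ∀ {A B C D} {f : A ⇒ B} {g : B ⇒ D} {h : A ⇒ C} {k : C ⇒ D} →
             g ∘ f ≈ k ∘ h → !₁ g ∘ !₁ f ≈ !₁ k ∘ !₁ h
  !-square p = ≈trans (≈sym !-homomorphism) (≈trans (!-resp-≈ p) !-homomorphism)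

  m-naturalˡ : ∀ {A A' B} {f : A ⇒ A'} → m A' B ∘ (!₁ f ⊗₁ id) ≈ !₁ (f ⊗₁ id) ∘ m A B
  m-naturalˡ = ≈trans (refl⟩∘⟨ ⊗-resp-≈ ≈refl (≈sym !-identity)) m-natural

  m-naturalʳ : ∀ {A B B'} {f : B ⇒ B'} → m A B' ∘ (id ⊗₁ !₁ f) ≈ !₁ (id ⊗₁ f) ∘ m A B
  m-naturalʳ = ≈trans (refl⟩∘⟨ ⊗-resp-≈ (≈sym !-identity) ≈refl) m-natural

  m-assoc′ : ∀ {A B C} → !₁ (α A B C) ∘ (m A (B ⊗₀ C) ∘ (id ⊗₁ m B C))
                           ≈ (m (A ⊗₀ B) C ∘ (m A B ⊗₁ id)) ∘ α (!₀ A) (!₀ B) (!₀ C)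
  m-assoc′ = ≈trans m-assoc sym-assoc

  m-assoc⁻¹ : ∀ {A B C} → !₁ (α⁻¹ A B C) ∘ (m (A ⊗₀ B) C ∘ (m A B ⊗₁ id))
                            ≈ (m A (B ⊗₀ C) ∘ (id ⊗₁ m B C)) ∘ α⁻¹ (!₀ A) (!₀ B) (!₀ C)
  m-assoc⁻¹ = ≈sym (square-invert (!-inverse α-isoˡ) α-isoʳ m-assoc′)

  m-unitˡ⁻¹ : ∀ {X} → m K X ∘ ((mK ⊗₁ id) ∘ ℓ⁻¹ (!₀ X)) ≈ !₁ (ℓ⁻¹ X)
  m-unitˡ⁻¹ {X} = section-cancelˡ (!-inverse ℓ-isoˡ) (begin
    !₁ (ℓ X) ∘ (m K X ∘ ((mK ⊗₁ id) ∘ ℓ⁻¹ (!₀ X)))  ≈⟨ ≈trans (refl⟩∘⟨ sym-assoc) sym-assoc ⟩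
    (!₁ (ℓ X) ∘ (m K X ∘ (mK ⊗₁ id))) ∘ ℓ⁻¹ (!₀ X)  ≈⟨ m-unitˡ ⟩∘⟨refl ⟩
    ℓ (!₀ X) ∘ ℓ⁻¹ (!₀ X)                           ≈⟨ ℓ-isoʳ ⟩
    id                                              ≈⟨ ≈sym (!-inverse ℓ-isoʳ) ⟩
    !₁ (ℓ X) ∘ !₁ (ℓ⁻¹ X)                           ∎)

  m-id⊗-square : ∀ {A X X' Y Y'} {f : X ⇒ X'} {p : Y ⇒ !₀ X} {q : Y' ⇒ !₀ X'} {g : Y ⇒ Y'} →
                 !₁ f ∘ p ≈ q ∘ g →
                 !₁ (id ⊗₁ f) ∘ (m A X ∘ (id ⊗₁ p)) ≈ (m A X' ∘ (id ⊗₁ q)) ∘ (id ⊗₁ g)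
  m-id⊗-square {f = f} {p} {q} {g} sq = begin
    !₁ (id ⊗₁ f) ∘ (m _ _ ∘ (id ⊗₁ p))  ≈⟨ sym-assoc ⟩
    (!₁ (id ⊗₁ f) ∘ m _ _) ∘ (id ⊗₁ p)  ≈⟨ ≈sym m-naturalʳ ⟩∘⟨refl ⟩
    (m _ _ ∘ (id ⊗₁ !₁ f)) ∘ (id ⊗₁ p)  ≈⟨ pullʳ id⊗-∘ ⟩
    m _ _ ∘ (id ⊗₁ (!₁ f ∘ p))          ≈⟨ refl⟩∘⟨ id⊗-resp-≈ sq ⟩
    m _ _ ∘ (id ⊗₁ (q ∘ g))             ≈⟨ refl⟩∘⟨ ≈sym id⊗-∘ ⟩
    m _ _ ∘ ((id ⊗₁ q) ∘ (id ⊗₁ g))     ≈⟨ sym-assoc ⟩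
    (m _ _ ∘ (id ⊗₁ q)) ∘ (id ⊗₁ g)     ∎

  m⊗m-α⁻¹ : ∀ {A B C D} →
    !₁ (α⁻¹ A B (C ⊗₀ D)) ∘ (m (A ⊗₀ B) (C ⊗₀ D) ∘ (m A B ⊗₁ m C D))
      ≈ (m A (B ⊗₀ (C ⊗₀ D)) ∘ (id ⊗₁ (m B (C ⊗₀ D) ∘ (id ⊗₁ m C D)))) ∘ α⁻¹ (!₀ A) (!₀ B) (!₀ C ⊗₀ !₀ D)
  m⊗m-α⁻¹ {A} {B} {C} {D} = begin
    !₁ (α⁻¹ _ _ _) ∘ (m _ _ ∘ (m A B ⊗₁ m C D))
      ≈⟨ refl⟩∘⟨ refl⟩∘⟨ ⊗-split₁₂ ⟩
    !₁ (α⁻¹ _ _ _) ∘ (m _ _ ∘ ((m A B ⊗₁ id) ∘ (id ⊗₁ m C D)))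
      ≈⟨ ≈trans (refl⟩∘⟨ sym-assoc) sym-assoc ⟩
    (!₁ (α⁻¹ _ _ _) ∘ (m _ _ ∘ (m A B ⊗₁ id))) ∘ (id ⊗₁ m C D)
      ≈⟨ m-assoc⁻¹ ⟩∘⟨refl ⟩
    ((m _ _ ∘ (id ⊗₁ m B (C ⊗₀ D))) ∘ α⁻¹ _ _ _) ∘ (id ⊗₁ m C D)
      ≈⟨ pullʳ (refl⟩∘⟨ ⊗-resp-≈ (≈sym ⊗-identity) ≈refl) ⟩
    (m _ _ ∘ (id ⊗₁ m B (C ⊗₀ D))) ∘ (α⁻¹ _ _ _ ∘ ((id ⊗₁ id) ⊗₁ m C D))
      ≈⟨ refl⟩∘⟨ α⁻¹-natural ⟩
    (m _ _ ∘ (id ⊗₁ m B (C ⊗₀ D))) ∘ ((id ⊗₁ (id ⊗₁ m C D)) ∘ α⁻¹ _ _ _)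
      ≈⟨ sym-assoc ⟩
    ((m _ _ ∘ (id ⊗₁ m B (C ⊗₀ D))) ∘ (id ⊗₁ (id ⊗₁ m C D))) ∘ α⁻¹ _ _ _
      ≈⟨ pullʳ id⊗-∘ ⟩∘⟨refl ⟩
    (m _ _ ∘ (id ⊗₁ (m B (C ⊗₀ D) ∘ (id ⊗₁ m C D)))) ∘ α⁻¹ _ _ _ ∎

  m⊗m-α : ∀ {A B C D} →
    !₁ (α A B (C ⊗₀ D)) ∘ (m A (B ⊗₀ (C ⊗₀ D)) ∘ (id ⊗₁ (m B (C ⊗₀ D) ∘ (id ⊗₁ m C D))))
      ≈ (m (A ⊗₀ B) (C ⊗₀ D) ∘ (m A B ⊗₁ m C D)) ∘ α (!₀ A) (!₀ B) (!₀ C ⊗₀ !₀ D)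
  m⊗m-α {A} {B} {C} {D} = begin
    !₁ (α _ _ _) ∘ (m _ _ ∘ (id ⊗₁ (m B (C ⊗₀ D) ∘ (id ⊗₁ m C D))))
      ≈⟨ refl⟩∘⟨ refl⟩∘⟨ ≈sym id⊗-∘ ⟩
    !₁ (α _ _ _) ∘ (m _ _ ∘ ((id ⊗₁ m B (C ⊗₀ D)) ∘ (id ⊗₁ (id ⊗₁ m C D))))
      ≈⟨ ≈trans (refl⟩∘⟨ sym-assoc) sym-assoc ⟩
    (!₁ (α _ _ _) ∘ (m _ _ ∘ (id ⊗₁ m B (C ⊗₀ D)))) ∘ (id ⊗₁ (id ⊗₁ m C D))
      ≈⟨ m-assoc′ ⟩∘⟨refl ⟩
    ((m _ _ ∘ (m A B ⊗₁ id)) ∘ α _ _ _) ∘ (id ⊗₁ (id ⊗₁ m C D))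
      ≈⟨ pullʳ α-natural ⟩
    (m _ _ ∘ (m A B ⊗₁ id)) ∘ (((id ⊗₁ id) ⊗₁ m C D) ∘ α _ _ _)
      ≈⟨ sym-assoc ⟩
    ((m _ _ ∘ (m A B ⊗₁ id)) ∘ ((id ⊗₁ id) ⊗₁ m C D)) ∘ α _ _ _
      ≈⟨ pullʳ (≈trans ⊗-∘ (⊗-resp-≈ (≈trans (refl⟩∘⟨ ⊗-identity) identityʳ) identityˡ)) ⟩∘⟨refl ⟩
    (m _ _ ∘ (m A B ⊗₁ m C D)) ∘ α _ _ _ ∎

  m-σ⊗id : ∀ {B C D} → !₁ (σ B C ⊗₁ id) ∘ (m (B ⊗₀ C) D ∘ (m B C ⊗₁ id))
                         ≈ (m (C ⊗₀ B) D ∘ (m C B ⊗₁ id)) ∘ (σ (!₀ B) (!₀ C) ⊗₁ id { !₀ D})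
  m-σ⊗id {B} {C} = begin
    !₁ (σ B C ⊗₁ id) ∘ (m _ _ ∘ (m B C ⊗₁ id))    ≈⟨ pullˡ (≈sym m-naturalˡ) ⟩
    (m _ _ ∘ (!₁ (σ B C) ⊗₁ id)) ∘ (m B C ⊗₁ id)  ≈⟨ pullʳ ⊗id-∘ ⟩
    m _ _ ∘ ((!₁ (σ B C) ∘ m B C) ⊗₁ id)          ≈⟨ refl⟩∘⟨ ⊗id-resp-≈ m-symmetric ⟩
    m _ _ ∘ ((m C B ∘ σ _ _) ⊗₁ id)               ≈⟨ refl⟩∘⟨ ≈sym ⊗id-∘ ⟩
    m _ _ ∘ ((m C B ⊗₁ id) ∘ (σ _ _ ⊗₁ id))       ≈⟨ sym-assoc ⟩
    (m _ _ ∘ (m C B ⊗₁ id)) ∘ (σ _ _ ⊗₁ id)       ∎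

  m-τ : ∀ {A B C D} →
    !₁ (τ A B C D) ∘ (m (A ⊗₀ B) (C ⊗₀ D) ∘ (m A B ⊗₁ m C D))
      ≈ (m (A ⊗₀ C) (B ⊗₀ D) ∘ (m A C ⊗₁ m B D)) ∘ τ (!₀ A) (!₀ B) (!₀ C) (!₀ D)
  m-τ {A} {B} {C} {D} = ≈trans (!τ ⟩∘⟨refl)
    (paste (paste (paste (paste m⊗m-α⁻¹ (m-id⊗-square {A = A} m-assoc′))
                         (m-id⊗-square m-σ⊗id))
                  (m-id⊗-square {A = A} m-assoc⁻¹))
           m⊗m-α)
    where
      !τ : !₁ (τ A B C D) ≈ !₁ (α A C (B ⊗₀ D)) ∘ (!₁ (id ⊗₁ α⁻¹ C B D) ∘ (!₁ (id ⊗₁ (σ B C ⊗₁ id))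
                              ∘ (!₁ (id ⊗₁ α B C D) ∘ !₁ (α⁻¹ A B (C ⊗₀ D)))))
      !τ = ≈trans !-homomorphism (refl⟩∘⟨ ≈trans !-homomorphism
             (refl⟩∘⟨ ≈trans !-homomorphism (refl⟩∘⟨ !-homomorphism)))

  m-⊗id-unitʳ : ∀ {A B} {g : A ⇒ !₀ B} → !₁ (ρ B) ∘ ((m B K ∘ (g ⊗₁ id)) ∘ (id ⊗₁ mK)) ≈ g ∘ ρ A
  m-⊗id-unitʳ {A} {B} {g} = begin
    !₁ (ρ B) ∘ ((m B K ∘ (g ⊗₁ id)) ∘ (id ⊗₁ mK))  ≈⟨ refl⟩∘⟨ pullʳ ⊗-commute ⟩
    !₁ (ρ B) ∘ (m B K ∘ ((id ⊗₁ mK) ∘ (g ⊗₁ id)))  ≈⟨ ≈trans (refl⟩∘⟨ sym-assoc) sym-assoc ⟩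
    (!₁ (ρ B) ∘ (m B K ∘ (id ⊗₁ mK))) ∘ (g ⊗₁ id)  ≈⟨ m-unitʳ ⟩∘⟨refl ⟩
    ρ (!₀ B) ∘ (g ⊗₁ id)                           ≈⟨ ρ-natural ⟩
    g ∘ ρ A                                        ∎

  m-⊗id-retraction : ∀ {A B} {g : A ⇒ !₀ B} →
                     !₁ (ρ B) ∘ ((m B K ∘ (g ⊗₁ id)) ∘ ((id ⊗₁ mK) ∘ ρ⁻¹ A)) ≈ g
  m-⊗id-retraction = ≈trans (refl⟩∘⟨ sym-assoc) (≈trans sym-assoc (≈trans (m-⊗id-unitʳ ⟩∘⟨refl) (cancelʳ ρ-isoʳ)))

  m-⊗id-injective : ∀ {A B} {g g' : A ⇒ !₀ B} → m B K ∘ (g ⊗₁ id) ≈ m B K ∘ (g' ⊗₁ id) → g ≈ g'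
  m-⊗id-injective p = ≈trans (≈sym m-⊗id-retraction) (≈trans (refl⟩∘⟨ (p ⟩∘⟨refl)) m-⊗id-retraction)

  m-⊗m-unitˡ : ∀ {A B X} {g : A ⇒ !₀ B} →
               !₁ (id ⊗₁ ℓ X) ∘ ((m B (K ⊗₀ X) ∘ (g ⊗₁ m K X)) ∘ (id ⊗₁ ((mK ⊗₁ id) ∘ ℓ⁻¹ (!₀ X))))
                 ≈ m B X ∘ (g ⊗₁ id)
  m-⊗m-unitˡ {A} {B} {X} {g} = begin
    !₁ (id ⊗₁ ℓ X) ∘ ((m _ _ ∘ (g ⊗₁ m K X)) ∘ (id ⊗₁ j))  ≈⟨ refl⟩∘⟨ pullʳ (≈trans ⊗-∘ (⊗-resp-≈ identityʳ ≈refl)) ⟩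
    !₁ (id ⊗₁ ℓ X) ∘ (m _ _ ∘ (g ⊗₁ (m K X ∘ j)))          ≈⟨ pullˡ (≈sym m-naturalʳ) ⟩
    (m B X ∘ (id ⊗₁ !₁ (ℓ X))) ∘ (g ⊗₁ (m K X ∘ j))        ≈⟨ pullʳ (≈trans ⊗-∘ (⊗-resp-≈ identityˡ ≈refl)) ⟩
    m B X ∘ (g ⊗₁ (!₁ (ℓ X) ∘ (m K X ∘ j)))                ≈⟨ refl⟩∘⟨ ⊗-resp-≈ ≈refl (refl⟩∘⟨ m-unitˡ⁻¹) ⟩
    m B X ∘ (g ⊗₁ (!₁ (ℓ X) ∘ !₁ (ℓ⁻¹ X)))                 ≈⟨ refl⟩∘⟨ ⊗-resp-≈ ≈refl (!-inverse ℓ-isoʳ) ⟩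
    m B X ∘ (g ⊗₁ id)                                      ∎
    where
      j : !₀ X ⇒ (!₀ K ⊗₀ !₀ X)
      j = (mK ⊗₁ id) ∘ ℓ⁻¹ (!₀ X)

  m-⊗m-injective : ∀ {A B} {g g' : A ⇒ !₀ B} →
                   m B (K ⊗₀ K) ∘ (g ⊗₁ m K K) ≈ m B (K ⊗₀ K) ∘ (g' ⊗₁ m K K) → g ≈ g'
  m-⊗m-injective p = m-⊗id-injective
    (≈trans (≈sym m-⊗m-unitˡ) (≈trans (refl⟩∘⟨ (p ⟩∘⟨refl)) m-⊗m-unitˡ))

  m-⊗id-ℓ⁻¹ : ∀ {A X} {u : K ⇒ A} → !₁ ((u ⊗₁ id) ∘ ℓ⁻¹ X) ≈ m A X ∘ (((!₁ u ∘ mK) ⊗₁ id) ∘ ℓ⁻¹ (!₀ X))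
  m-⊗id-ℓ⁻¹ {A} {X} {u} = ≈sym (begin
    m A X ∘ (((!₁ u ∘ mK) ⊗₁ id) ∘ ℓ⁻¹ (!₀ X))          ≈⟨ refl⟩∘⟨ pushˡ (≈sym ⊗id-∘) ⟩
    m A X ∘ ((!₁ u ⊗₁ id) ∘ ((mK ⊗₁ id) ∘ ℓ⁻¹ (!₀ X)))  ≈⟨ pullˡ m-naturalˡ ⟩
    (!₁ (u ⊗₁ id) ∘ m K X) ∘ ((mK ⊗₁ id) ∘ ℓ⁻¹ (!₀ X))  ≈⟨ pullʳ m-unitˡ⁻¹ ⟩
    !₁ (u ⊗₁ id) ∘ !₁ (ℓ⁻¹ X)                           ≈⟨ ≈sym !-homomorphism ⟩
    !₁ ((u ⊗₁ id) ∘ ℓ⁻¹ X)                              ∎)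

module Correspondence {o h e} (𝕏 : SymMonCat o h e) (C : SymMonComonad 𝕏) (H : SymMonCat.Obj 𝕏) where
  open SymMonCat 𝕏
  open SymMonComonad C
  open SymMonCatProperties 𝕏
  open HomReasoning
  open SymMonComonadProperties 𝕏 C
  open Structures 𝕏 C

  Law : Set (o ⊔ h)
  Law = ∀ X → (H ⊗₀ !₀ X) ⇒ !₀ (H ⊗₀ X)

  lawOf : H ⇒ !₀ H → Law
  lawOf ω X = m H X ∘ (ω ⊗₁ id)

  ρ⁻¹-mK : H ⇒ (H ⊗₀ !₀ K)
  ρ⁻¹-mK = (id ⊗₁ mK) ∘ ρ⁻¹ H

  coactionOf : Law → H ⇒ !₀ H
  coactionOf lam = !₁ (ρ H) ∘ (lam K ∘ ρ⁻¹-mK)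

  coactionOf-resp-≈ : ∀ {lam lam' : Law} → (∀ X → lam X ≈ lam' X) → coactionOf lam ≈ coactionOf lam'
  coactionOf-resp-≈ p = refl⟩∘⟨ (p K ⟩∘⟨refl)

  lawOf-resp-≈ : ∀ {ω ω' : H ⇒ !₀ H} {X} → ω ≈ ω' → lawOf ω X ≈ lawOf ω' X
  lawOf-resp-≈ p = refl⟩∘⟨ ⊗id-resp-≈ p

  coactionOf-lawOf : ∀ {ω : H ⇒ !₀ H} → coactionOf (lawOf ω) ≈ ω
  coactionOf-lawOf = m-⊗id-retraction

  IsNatural : Law → Set (o ⊔ h ⊔ e)
  IsNatural lam = ∀ {X Y} {f : X ⇒ Y} → lam Y ∘ (id ⊗₁ !₁ f) ≈ !₁ (id ⊗₁ f) ∘ lam X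

  IsAssociative : Law → Set (o ⊔ e)
  IsAssociative lam = ∀ {X Y} →
    !₁ (α H X Y) ∘ (lam (X ⊗₀ Y) ∘ (id ⊗₁ m X Y)) ≈ m (H ⊗₀ X) Y ∘ ((lam X ⊗₁ id) ∘ α H (!₀ X) (!₀ Y))

  -- Insert 1 = !ℓ ∘ !ℓ⁻¹ with !ℓ⁻¹ = m ∘ (m_K ⊗ 1) ∘ ℓ⁻¹; naturality moves !ℓ past λ, the
  -- α-condition splits λ_{K⊗X}, and what acts on the H-factor is then the coaction of λ.
  lawOf-coactionOf : ∀ {lam : Law} → IsNatural lam → IsAssociative lam → ∀ X → lam X ≈ lawOf (coactionOf lam) X
  lawOf-coactionOf {lam} natural assoc-law X = begin
    lam X
      ≈⟨ ≈sym (≈trans (refl⟩∘⟨ ≈trans (id⊗-resp-≈ (!-inverse ℓ-isoʳ)) ⊗-identity) identityʳ) ⟩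
    lam X ∘ (id ⊗₁ (!₁ (ℓ X) ∘ !₁ (ℓ⁻¹ X)))
      ≈⟨ refl⟩∘⟨ id⊗-resp-≈ (refl⟩∘⟨ ≈sym m-unitˡ⁻¹) ⟩
    lam X ∘ (id ⊗₁ (!₁ (ℓ X) ∘ (m K X ∘ ((mK ⊗₁ id) ∘ ℓ⁻¹ (!₀ X)))))
      ≈⟨ refl⟩∘⟨ ≈sym (≈trans (refl⟩∘⟨ ≈trans (refl⟩∘⟨ id⊗-∘) id⊗-∘) id⊗-∘) ⟩
    lam X ∘ ((id ⊗₁ !₁ (ℓ X)) ∘ ((id ⊗₁ m K X) ∘ j))
      ≈⟨ pullˡ natural ⟩
    (!₁ (id ⊗₁ ℓ X) ∘ lam (K ⊗₀ X)) ∘ ((id ⊗₁ m K X) ∘ j)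
      ≈⟨ (≈trans (!-resp-≈ (≈sym triangle)) !-homomorphism ⟩∘⟨refl) ⟩∘⟨refl ⟩
    ((!₁ (ρ H ⊗₁ id) ∘ !₁ (α H K X)) ∘ lam (K ⊗₀ X)) ∘ ((id ⊗₁ m K X) ∘ j)
      ≈⟨ ≈trans assoc (≈trans assoc (refl⟩∘⟨ ≈trans (refl⟩∘⟨ sym-assoc) sym-assoc)) ⟩
    !₁ (ρ H ⊗₁ id) ∘ ((!₁ (α H K X) ∘ (lam (K ⊗₀ X) ∘ (id ⊗₁ m K X))) ∘ j)
      ≈⟨ refl⟩∘⟨ (assoc-law ⟩∘⟨refl) ⟩
    !₁ (ρ H ⊗₁ id) ∘ ((m (H ⊗₀ K) X ∘ ((lam K ⊗₁ id) ∘ α H (!₀ K) (!₀ X))) ∘ j)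
      ≈⟨ refl⟩∘⟨ ≈trans assoc (refl⟩∘⟨ ≈trans assoc (refl⟩∘⟨ α∘j)) ⟩
    !₁ (ρ H ⊗₁ id) ∘ (m (H ⊗₀ K) X ∘ ((lam K ⊗₁ id) ∘ (((id ⊗₁ mK) ⊗₁ id) ∘ (ρ⁻¹ H ⊗₁ id))))
      ≈⟨ pullˡ (≈sym m-naturalˡ) ⟩
    (m H X ∘ (!₁ (ρ H) ⊗₁ id)) ∘ ((lam K ⊗₁ id) ∘ (((id ⊗₁ mK) ⊗₁ id) ∘ (ρ⁻¹ H ⊗₁ id)))
      ≈⟨ pullʳ (≈trans (refl⟩∘⟨ ≈trans (refl⟩∘⟨ ⊗id-∘) ⊗id-∘) ⊗id-∘) ⟩
    lawOf (coactionOf lam) X ∎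
    where
      j : (H ⊗₀ !₀ X) ⇒ (H ⊗₀ (!₀ K ⊗₀ !₀ X))
      j = (id ⊗₁ (mK ⊗₁ id)) ∘ (id ⊗₁ ℓ⁻¹ (!₀ X))
      α∘j : α H (!₀ K) (!₀ X) ∘ j ≈ ((id ⊗₁ mK) ⊗₁ id) ∘ (ρ⁻¹ H ⊗₁ id)
      α∘j = begin
        α H (!₀ K) (!₀ X) ∘ ((id ⊗₁ (mK ⊗₁ id)) ∘ (id ⊗₁ ℓ⁻¹ (!₀ X)))  ≈⟨ pullˡ α-natural ⟩
        (((id ⊗₁ mK) ⊗₁ id) ∘ α H K (!₀ X)) ∘ (id ⊗₁ ℓ⁻¹ (!₀ X))       ≈⟨ pullʳ (≈sym triangle⁻¹) ⟩
        ((id ⊗₁ mK) ⊗₁ id) ∘ (ρ⁻¹ H ⊗₁ id)                             ∎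

  module LawOf (ω : H ⇒ !₀ H) where

    lawOf-⊗id : ∀ {X A B} {f : A ⇒ H} {k : B ⇒ (A ⊗₀ !₀ X)} →
                lawOf ω X ∘ ((f ⊗₁ id) ∘ k) ≈ m H X ∘ (((ω ∘ f) ⊗₁ id) ∘ k)
    lawOf-⊗id = ≈trans assoc (refl⟩∘⟨ ≈trans sym-assoc (⊗id-∘ ⟩∘⟨refl))

    lawOf-natural : IsNatural (lawOf ω)
    lawOf-natural {X} {Y} {f} = begin
      (m H Y ∘ (ω ⊗₁ id)) ∘ (id ⊗₁ !₁ f)  ≈⟨ pullʳ (≈sym ⊗-split₁₂) ⟩
      m H Y ∘ (ω ⊗₁ !₁ f)                 ≈⟨ refl⟩∘⟨ ⊗-split₂₁ ⟩
      m H Y ∘ ((id ⊗₁ !₁ f) ∘ (ω ⊗₁ id))  ≈⟨ pullˡ m-naturalʳ ⟩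
      (!₁ (id ⊗₁ f) ∘ m H X) ∘ (ω ⊗₁ id)  ≈⟨ assoc ⟩
      !₁ (id ⊗₁ f) ∘ lawOf ω X            ∎

    lawOf-associative : IsAssociative (lawOf ω)
    lawOf-associative {X} {Y} = begin
      !₁ (α H X Y) ∘ ((m H (X ⊗₀ Y) ∘ (ω ⊗₁ id)) ∘ (id ⊗₁ m X Y))
        ≈⟨ refl⟩∘⟨ pullʳ ⊗-commute ⟩
      !₁ (α H X Y) ∘ (m H (X ⊗₀ Y) ∘ ((id ⊗₁ m X Y) ∘ (ω ⊗₁ id)))
        ≈⟨ ≈trans (refl⟩∘⟨ sym-assoc) sym-assoc ⟩
      (!₁ (α H X Y) ∘ (m H (X ⊗₀ Y) ∘ (id ⊗₁ m X Y))) ∘ (ω ⊗₁ id)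
        ≈⟨ m-assoc′ ⟩∘⟨ ⊗-resp-≈ ≈refl (≈sym ⊗-identity) ⟩
      ((m (H ⊗₀ X) Y ∘ (m H X ⊗₁ id)) ∘ α _ _ _) ∘ (ω ⊗₁ (id ⊗₁ id))
        ≈⟨ pullʳ α-natural ⟩
      (m (H ⊗₀ X) Y ∘ (m H X ⊗₁ id)) ∘ (((ω ⊗₁ id) ⊗₁ id) ∘ α _ _ _)
        ≈⟨ pullʳ (pullˡ ⊗id-∘) ⟩
      m (H ⊗₀ X) Y ∘ ((lawOf ω X ⊗₁ id) ∘ α H (!₀ X) (!₀ Y)) ∎

    lawOf-ε : ∀ {X} → ε H ∘ ω ≈ id → ε (H ⊗₀ X) ∘ lawOf ω X ≈ id ⊗₁ ε X
    lawOf-ε counit = ≈trans (pullˡ ε-monoidal) (≈trans ⊗-∘ (⊗-resp-≈ counit identityʳ))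

    lawOf-δ : ∀ {X} → δ H ∘ ω ≈ !₁ ω ∘ ω →
              δ (H ⊗₀ X) ∘ lawOf ω X ≈ !₁ (lawOf ω X) ∘ (lawOf ω (!₀ X) ∘ (id ⊗₁ δ X))
    lawOf-δ {X} coassoc = begin
      δ (H ⊗₀ X) ∘ (m H X ∘ (ω ⊗₁ id))
        ≈⟨ pullˡ δ-monoidal ⟩
      (!₁ (m H X) ∘ (m (!₀ H) (!₀ X) ∘ (δ H ⊗₁ δ X))) ∘ (ω ⊗₁ id)
        ≈⟨ pullʳ (pullʳ (≈trans ⊗-∘ (⊗-resp-≈ coassoc identityʳ))) ⟩
      !₁ (m H X) ∘ (m (!₀ H) (!₀ X) ∘ ((!₁ ω ∘ ω) ⊗₁ δ X))
        ≈⟨ refl⟩∘⟨ refl⟩∘⟨ ≈trans (⊗-resp-≈ ≈refl (≈sym identityˡ)) ⊗-homomorphism ⟩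
      !₁ (m H X) ∘ (m (!₀ H) (!₀ X) ∘ ((!₁ ω ⊗₁ id) ∘ (ω ⊗₁ δ X)))
        ≈⟨ refl⟩∘⟨ pullˡ m-naturalˡ ⟩
      !₁ (m H X) ∘ ((!₁ (ω ⊗₁ id) ∘ m H (!₀ X)) ∘ (ω ⊗₁ δ X))
        ≈⟨ ≈trans sym-assoc (pullˡ (≈sym !-homomorphism) ⟩∘⟨refl) ⟩
      (!₁ (lawOf ω X) ∘ m H (!₀ X)) ∘ (ω ⊗₁ δ X)
        ≈⟨ pullʳ (refl⟩∘⟨ ⊗-split₁₂) ⟩
      !₁ (lawOf ω X) ∘ (m H (!₀ X) ∘ ((ω ⊗₁ id) ∘ (id ⊗₁ δ X)))
        ≈⟨ refl⟩∘⟨ sym-assoc ⟩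
      !₁ (lawOf ω X) ∘ (lawOf ω (!₀ X) ∘ (id ⊗₁ δ X)) ∎

    lawOf-μ-rhs : ∀ {∇ : (H ⊗₀ H) ⇒ H} X →
      !₁ ((∇ ⊗₁ id) ∘ α H H X) ∘ (lawOf ω (H ⊗₀ X) ∘ (id ⊗₁ lawOf ω X))
        ≈ m H X ∘ (((!₁ ∇ ∘ (m H H ∘ (ω ⊗₁ ω))) ⊗₁ id) ∘ α H H (!₀ X))
    lawOf-μ-rhs {∇} X = begin
      !₁ ((∇ ⊗₁ id) ∘ α H H X) ∘ ((m H (H ⊗₀ X) ∘ (ω ⊗₁ id)) ∘ (id ⊗₁ lawOf ω X))
        ≈⟨ !-homomorphism ⟩∘⟨ pullʳ (≈trans ⊗-∘ (≈trans (⊗-resp-≈ (≈trans identityʳ (≈sym identityˡ)) identityˡ) ⊗-homomorphism)) ⟩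
      (!₁ (∇ ⊗₁ id) ∘ !₁ (α H H X)) ∘ (m H (H ⊗₀ X) ∘ ((id ⊗₁ m H X) ∘ (ω ⊗₁ (ω ⊗₁ id))))
        ≈⟨ pullʳ (≈trans (refl⟩∘⟨ sym-assoc) sym-assoc) ⟩
      !₁ (∇ ⊗₁ id) ∘ ((!₁ (α H H X) ∘ (m H (H ⊗₀ X) ∘ (id ⊗₁ m H X))) ∘ (ω ⊗₁ (ω ⊗₁ id)))
        ≈⟨ refl⟩∘⟨ (m-assoc′ ⟩∘⟨refl) ⟩
      !₁ (∇ ⊗₁ id) ∘ (((m (H ⊗₀ H) X ∘ (m H H ⊗₁ id)) ∘ α _ _ _) ∘ (ω ⊗₁ (ω ⊗₁ id)))
        ≈⟨ refl⟩∘⟨ pullʳ α-natural ⟩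
      !₁ (∇ ⊗₁ id) ∘ ((m (H ⊗₀ H) X ∘ (m H H ⊗₁ id)) ∘ (((ω ⊗₁ ω) ⊗₁ id) ∘ α _ _ _))
        ≈⟨ ≈trans (refl⟩∘⟨ assoc) (pullˡ (≈sym m-naturalˡ)) ⟩
      (m H X ∘ (!₁ ∇ ⊗₁ id)) ∘ ((m H H ⊗₁ id) ∘ (((ω ⊗₁ ω) ⊗₁ id) ∘ α _ _ _))
        ≈⟨ pullʳ (≈trans (refl⟩∘⟨ sym-assoc) (≈trans sym-assoc ((≈trans (refl⟩∘⟨ ⊗id-∘) ⊗id-∘) ⟩∘⟨refl))) ⟩
      m H X ∘ (((!₁ ∇ ∘ (m H H ∘ (ω ⊗₁ ω))) ⊗₁ id) ∘ α H H (!₀ X)) ∎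

    ∇-coalg⇒law-μ : ∀ {∇ : (H ⊗₀ H) ⇒ H} → ω ∘ ∇ ≈ !₁ ∇ ∘ (m H H ∘ (ω ⊗₁ ω)) → ∀ {X} →
      lawOf ω X ∘ ((∇ ⊗₁ id) ∘ α H H (!₀ X))
        ≈ !₁ ((∇ ⊗₁ id) ∘ α H H X) ∘ (lawOf ω (H ⊗₀ X) ∘ (id ⊗₁ lawOf ω X))
    ∇-coalg⇒law-μ ∇-coalg {X} =
      ≈trans lawOf-⊗id (≈trans (refl⟩∘⟨ (⊗id-resp-≈ ∇-coalg ⟩∘⟨refl)) (≈sym (lawOf-μ-rhs X)))

    law-μ⇒∇-coalg : ∀ {∇ : (H ⊗₀ H) ⇒ H} →
      lawOf ω K ∘ ((∇ ⊗₁ id) ∘ α H H (!₀ K))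
        ≈ !₁ ((∇ ⊗₁ id) ∘ α H H K) ∘ (lawOf ω (H ⊗₀ K) ∘ (id ⊗₁ lawOf ω K)) →
      ω ∘ ∇ ≈ !₁ ∇ ∘ (m H H ∘ (ω ⊗₁ ω))
    law-μ⇒∇-coalg law-μ = m-⊗id-injective (retraction-cancelʳ α-isoʳ
      (≈trans assoc (≈trans (≈sym lawOf-⊗id) (≈trans law-μ (≈trans (lawOf-μ-rhs K) sym-assoc)))))

    u-coalg⇒law-η : ∀ {u : K ⇒ H} → ω ∘ u ≈ !₁ u ∘ mK → ∀ {X} →
      lawOf ω X ∘ ((u ⊗₁ id) ∘ ℓ⁻¹ (!₀ X)) ≈ !₁ ((u ⊗₁ id) ∘ ℓ⁻¹ X)
    u-coalg⇒law-η u-coalg = ≈trans lawOf-⊗id (≈trans (refl⟩∘⟨ (⊗id-resp-≈ u-coalg ⟩∘⟨refl)) (≈sym m-⊗id-ℓ⁻¹))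

    law-η⇒u-coalg : ∀ {u : K ⇒ H} →
      lawOf ω K ∘ ((u ⊗₁ id) ∘ ℓ⁻¹ (!₀ K)) ≈ !₁ ((u ⊗₁ id) ∘ ℓ⁻¹ K) → ω ∘ u ≈ !₁ u ∘ mK
    law-η⇒u-coalg law-η = m-⊗id-injective (retraction-cancelʳ ℓ-isoˡ
      (≈trans assoc (≈trans (≈sym lawOf-⊗id) (≈trans law-η (≈trans m-⊗id-ℓ⁻¹ sym-assoc)))))

    lawOf-n-lhs : ∀ {Δ : H ⇒ (H ⊗₀ H)} X Y →
      !₁ (τ H H X Y ∘ (Δ ⊗₁ id)) ∘ (lawOf ω (X ⊗₀ Y) ∘ (id ⊗₁ m X Y))
        ≈ !₁ (τ H H X Y) ∘ (m (H ⊗₀ H) (X ⊗₀ Y) ∘ ((!₁ Δ ∘ ω) ⊗₁ m X Y))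
    lawOf-n-lhs {Δ} X Y = begin
      !₁ (τ H H X Y ∘ (Δ ⊗₁ id)) ∘ ((m H (X ⊗₀ Y) ∘ (ω ⊗₁ id)) ∘ (id ⊗₁ m X Y))
        ≈⟨ !-homomorphism ⟩∘⟨ pullʳ (≈sym ⊗-split₁₂) ⟩
      (!₁ (τ H H X Y) ∘ !₁ (Δ ⊗₁ id)) ∘ (m H (X ⊗₀ Y) ∘ (ω ⊗₁ m X Y))
        ≈⟨ pullʳ (pullˡ (≈sym m-naturalˡ)) ⟩
      !₁ (τ H H X Y) ∘ ((m (H ⊗₀ H) (X ⊗₀ Y) ∘ (!₁ Δ ⊗₁ id)) ∘ (ω ⊗₁ m X Y))
        ≈⟨ refl⟩∘⟨ pullʳ (≈trans ⊗-∘ (⊗-resp-≈ ≈refl identityˡ)) ⟩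
      !₁ (τ H H X Y) ∘ (m (H ⊗₀ H) (X ⊗₀ Y) ∘ ((!₁ Δ ∘ ω) ⊗₁ m X Y)) ∎

    lawOf-n-rhs : ∀ {Δ : H ⇒ (H ⊗₀ H)} X Y →
      m (H ⊗₀ X) (H ⊗₀ Y) ∘ ((lawOf ω X ⊗₁ lawOf ω Y) ∘ (τ H H (!₀ X) (!₀ Y) ∘ (Δ ⊗₁ id)))
        ≈ !₁ (τ H H X Y) ∘ (m (H ⊗₀ H) (X ⊗₀ Y) ∘ (((m H H ∘ (ω ⊗₁ ω)) ∘ Δ) ⊗₁ m X Y))
    lawOf-n-rhs {Δ} X Y = begin
      m (H ⊗₀ X) (H ⊗₀ Y) ∘ ((lawOf ω X ⊗₁ lawOf ω Y) ∘ (τ H H (!₀ X) (!₀ Y) ∘ (Δ ⊗₁ id)))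
        ≈⟨ refl⟩∘⟨ pushˡ ⊗-homomorphism ⟩
      m (H ⊗₀ X) (H ⊗₀ Y) ∘ ((m H X ⊗₁ m H Y) ∘ (((ω ⊗₁ id) ⊗₁ (ω ⊗₁ id)) ∘ (τ H H (!₀ X) (!₀ Y) ∘ (Δ ⊗₁ id))))
        ≈⟨ refl⟩∘⟨ refl⟩∘⟨ ≈trans (pullˡ (≈sym τ-natural)) assoc ⟩
      m (H ⊗₀ X) (H ⊗₀ Y) ∘ ((m H X ⊗₁ m H Y) ∘ (τ (!₀ H) (!₀ H) (!₀ X) (!₀ Y) ∘ (((ω ⊗₁ ω) ⊗₁ (id ⊗₁ id)) ∘ (Δ ⊗₁ id))))
        ≈⟨ refl⟩∘⟨ refl⟩∘⟨ refl⟩∘⟨ ≈trans ⊗-∘ (⊗-resp-≈ ≈refl (≈trans identityʳ ⊗-identity)) ⟩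
      m (H ⊗₀ X) (H ⊗₀ Y) ∘ ((m H X ⊗₁ m H Y) ∘ (τ (!₀ H) (!₀ H) (!₀ X) (!₀ Y) ∘ (((ω ⊗₁ ω) ∘ Δ) ⊗₁ id)))
        ≈⟨ ≈trans sym-assoc sym-assoc ⟩
      ((m (H ⊗₀ X) (H ⊗₀ Y) ∘ (m H X ⊗₁ m H Y)) ∘ τ (!₀ H) (!₀ H) (!₀ X) (!₀ Y)) ∘ (((ω ⊗₁ ω) ∘ Δ) ⊗₁ id)
        ≈⟨ ≈sym m-τ ⟩∘⟨refl ⟩
      (!₁ (τ H H X Y) ∘ (m (H ⊗₀ H) (X ⊗₀ Y) ∘ (m H H ⊗₁ m X Y))) ∘ (((ω ⊗₁ ω) ∘ Δ) ⊗₁ id)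
        ≈⟨ pullʳ (pullʳ (≈trans ⊗-∘ (⊗-resp-≈ sym-assoc identityʳ))) ⟩
      !₁ (τ H H X Y) ∘ (m (H ⊗₀ H) (X ⊗₀ Y) ∘ (((m H H ∘ (ω ⊗₁ ω)) ∘ Δ) ⊗₁ m X Y)) ∎

    Δ-coalg⇒law-m : ∀ {Δ : H ⇒ (H ⊗₀ H)} → (m H H ∘ (ω ⊗₁ ω)) ∘ Δ ≈ !₁ Δ ∘ ω → ∀ {X Y} →
      !₁ (τ H H X Y ∘ (Δ ⊗₁ id)) ∘ (lawOf ω (X ⊗₀ Y) ∘ (id ⊗₁ m X Y))
        ≈ m (H ⊗₀ X) (H ⊗₀ Y) ∘ ((lawOf ω X ⊗₁ lawOf ω Y) ∘ (τ H H (!₀ X) (!₀ Y) ∘ (Δ ⊗₁ id)))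
    Δ-coalg⇒law-m Δ-coalg {X} {Y} = ≈trans (lawOf-n-lhs X Y)
      (≈trans (refl⟩∘⟨ refl⟩∘⟨ ⊗-resp-≈ (≈sym Δ-coalg) ≈refl) (≈sym (lawOf-n-rhs X Y)))

    law-m⇒Δ-coalg : ∀ {Δ : H ⇒ (H ⊗₀ H)} →
      !₁ (τ H H K K ∘ (Δ ⊗₁ id)) ∘ (lawOf ω (K ⊗₀ K) ∘ (id ⊗₁ m K K))
        ≈ m (H ⊗₀ K) (H ⊗₀ K) ∘ ((lawOf ω K ⊗₁ lawOf ω K) ∘ (τ H H (!₀ K) (!₀ K) ∘ (Δ ⊗₁ id))) →
      (m H H ∘ (ω ⊗₁ ω)) ∘ Δ ≈ !₁ Δ ∘ ω
    law-m⇒Δ-coalg law-m = ≈sym (m-⊗m-injective (section-cancelˡ (!-inverse τ-involutive)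
      (≈trans (≈sym (lawOf-n-lhs K K)) (≈trans law-m (lawOf-n-rhs K K)))))

    ẽ-coalg⇒law-mK : ∀ {ẽ : H ⇒ K} → mK ∘ ẽ ≈ !₁ ẽ ∘ ω →
      !₁ (ẽ ∘ ρ H) ∘ (lawOf ω K ∘ (id ⊗₁ mK)) ≈ mK ∘ (ẽ ∘ ρ H)
    ẽ-coalg⇒law-mK {ẽ} ẽ-coalg = begin
      !₁ (ẽ ∘ ρ H) ∘ (lawOf ω K ∘ (id ⊗₁ mK))       ≈⟨ !-homomorphism ⟩∘⟨refl ⟩
      (!₁ ẽ ∘ !₁ (ρ H)) ∘ (lawOf ω K ∘ (id ⊗₁ mK))  ≈⟨ pullʳ m-⊗id-unitʳ ⟩
      !₁ ẽ ∘ (ω ∘ ρ H)                              ≈⟨ pullˡ (≈sym ẽ-coalg) ⟩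
      (mK ∘ ẽ) ∘ ρ H                                ≈⟨ assoc ⟩
      mK ∘ (ẽ ∘ ρ H)                                ∎

    coalg-endo⇒lawOf-commute : ∀ {s : H ⇒ H} {X} → ω ∘ s ≈ !₁ s ∘ ω →
      lawOf ω X ∘ (s ⊗₁ id) ≈ !₁ (s ⊗₁ id) ∘ lawOf ω X
    coalg-endo⇒lawOf-commute {s} s-coalg = begin
      (m H _ ∘ (ω ⊗₁ id)) ∘ (s ⊗₁ id)     ≈⟨ pullʳ ⊗id-∘ ⟩
      m H _ ∘ ((ω ∘ s) ⊗₁ id)             ≈⟨ refl⟩∘⟨ ⊗id-resp-≈ s-coalg ⟩
      m H _ ∘ ((!₁ s ∘ ω) ⊗₁ id)          ≈⟨ refl⟩∘⟨ ≈sym ⊗id-∘ ⟩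
      m H _ ∘ ((!₁ s ⊗₁ id) ∘ (ω ⊗₁ id))  ≈⟨ pullˡ m-naturalˡ ⟩
      (!₁ (s ⊗₁ id) ∘ m H _) ∘ (ω ⊗₁ id)  ≈⟨ assoc ⟩
      !₁ (s ⊗₁ id) ∘ lawOf ω _            ∎

  module CoactionOf (lam : Law) where

    ω : H ⇒ !₀ H
    ω = coactionOf lam

    law-ε⇒counit : ε (H ⊗₀ K) ∘ lam K ≈ id ⊗₁ ε K → ε H ∘ ω ≈ id
    law-ε⇒counit law-ε = begin
      ε H ∘ (!₁ (ρ H) ∘ (lam K ∘ ρ⁻¹-mK))         ≈⟨ pullˡ ε-natural ⟩
      (ρ H ∘ ε (H ⊗₀ K)) ∘ (lam K ∘ ρ⁻¹-mK)       ≈⟨ pullʳ (pullˡ law-ε) ⟩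
      ρ H ∘ ((id ⊗₁ ε K) ∘ ((id ⊗₁ mK) ∘ ρ⁻¹ H))  ≈⟨ refl⟩∘⟨ cancelˡ (id⊗-inverse ε-monoidal-K) ⟩
      ρ H ∘ ρ⁻¹ H                                 ≈⟨ ρ-isoʳ ⟩
      id                                          ∎

    -- δ_K ∘ m_K = !m_K ∘ m_K turns the δ on the unit into an !m_K, which naturality moves past λ.
    law-δ⇒coassoc : IsNatural lam →
      δ (H ⊗₀ K) ∘ lam K ≈ !₁ (lam K) ∘ (lam (!₀ K) ∘ (id ⊗₁ δ K)) → δ H ∘ ω ≈ !₁ ω ∘ ω
    law-δ⇒coassoc natural law-δ = begin
      δ H ∘ (!₁ (ρ H) ∘ (lam K ∘ ρ⁻¹-mK))
        ≈⟨ pullˡ δ-natural ⟩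
      (!₁ (!₁ (ρ H)) ∘ δ (H ⊗₀ K)) ∘ (lam K ∘ ρ⁻¹-mK)
        ≈⟨ pullʳ (pullˡ law-δ) ⟩
      !₁ (!₁ (ρ H)) ∘ ((!₁ (lam K) ∘ (lam (!₀ K) ∘ (id ⊗₁ δ K))) ∘ ρ⁻¹-mK)
        ≈⟨ refl⟩∘⟨ pullʳ (pullʳ (≈trans (pullˡ δ-on-unit) assoc)) ⟩
      !₁ (!₁ (ρ H)) ∘ (!₁ (lam K) ∘ (lam (!₀ K) ∘ ((id ⊗₁ !₁ mK) ∘ ρ⁻¹-mK)))
        ≈⟨ refl⟩∘⟨ refl⟩∘⟨ pullˡ natural ⟩
      !₁ (!₁ (ρ H)) ∘ (!₁ (lam K) ∘ ((!₁ (id ⊗₁ mK) ∘ lam K) ∘ ρ⁻¹-mK))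
        ≈⟨ refl⟩∘⟨ refl⟩∘⟨ ≈trans assoc (refl⟩∘⟨ ≈sym (cancelˡ (!-inverse ρ-isoˡ))) ⟩
      !₁ (!₁ (ρ H)) ∘ (!₁ (lam K) ∘ (!₁ (id ⊗₁ mK) ∘ (!₁ (ρ⁻¹ H) ∘ ω)))
        ≈⟨ ≈sym (≈trans assoc (refl⟩∘⟨ ≈trans assoc (refl⟩∘⟨ assoc))) ⟩
      (!₁ (!₁ (ρ H)) ∘ (!₁ (lam K) ∘ (!₁ (id ⊗₁ mK) ∘ !₁ (ρ⁻¹ H)))) ∘ ω
        ≈⟨ ≈sym !ω ⟩∘⟨refl ⟩
      !₁ ω ∘ ω ∎
      where
        δ-on-unit : (id ⊗₁ δ K) ∘ (id ⊗₁ mK) ≈ (id {H} ⊗₁ !₁ mK) ∘ (id ⊗₁ mK)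
        δ-on-unit = ≈trans id⊗-∘ (≈trans (id⊗-resp-≈ δ-monoidal-K) (≈sym id⊗-∘))
        !ω : !₁ ω ≈ !₁ (!₁ (ρ H)) ∘ (!₁ (lam K) ∘ (!₁ (id ⊗₁ mK) ∘ !₁ (ρ⁻¹ H)))
        !ω = ≈trans !-homomorphism (refl⟩∘⟨ ≈trans !-homomorphism (refl⟩∘⟨ !-homomorphism))

    law-mK⇒ẽ-coalg : ∀ {ẽ : H ⇒ K} → !₁ (ẽ ∘ ρ H) ∘ (lam K ∘ (id ⊗₁ mK)) ≈ mK ∘ (ẽ ∘ ρ H) →
                     mK ∘ ẽ ≈ !₁ ẽ ∘ ω
    law-mK⇒ẽ-coalg {ẽ} law-mK = begin
      mK ∘ ẽ                                              ≈⟨ ≈sym (cancelʳ ρ-isoʳ) ⟩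
      ((mK ∘ ẽ) ∘ ρ H) ∘ ρ⁻¹ H                            ≈⟨ (assoc ⟩∘⟨refl) ⟩
      (mK ∘ (ẽ ∘ ρ H)) ∘ ρ⁻¹ H                            ≈⟨ ≈sym law-mK ⟩∘⟨refl ⟩
      (!₁ (ẽ ∘ ρ H) ∘ (lam K ∘ (id ⊗₁ mK))) ∘ ρ⁻¹ H       ≈⟨ (!-homomorphism ⟩∘⟨refl) ⟩∘⟨refl ⟩
      ((!₁ ẽ ∘ !₁ (ρ H)) ∘ (lam K ∘ (id ⊗₁ mK))) ∘ ρ⁻¹ H  ≈⟨ ≈trans assoc (≈trans assoc (refl⟩∘⟨ refl⟩∘⟨ assoc)) ⟩
      !₁ ẽ ∘ ω                                            ∎

    law-commute⇒coalg-endo : ∀ {s : H ⇒ H} → lam K ∘ (s ⊗₁ id) ≈ !₁ (s ⊗₁ id) ∘ lam K →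
                             ω ∘ s ≈ !₁ s ∘ ω
    law-commute⇒coalg-endo {s} commute = begin
      (!₁ (ρ H) ∘ (lam K ∘ ρ⁻¹-mK)) ∘ s
        ≈⟨ pullʳ (pullʳ (pullʳ ρ⁻¹-natural)) ⟩
      !₁ (ρ H) ∘ (lam K ∘ ((id ⊗₁ mK) ∘ ((s ⊗₁ id) ∘ ρ⁻¹ H)))
        ≈⟨ refl⟩∘⟨ refl⟩∘⟨ ≈trans (pullˡ (≈sym ⊗-commute)) assoc ⟩
      !₁ (ρ H) ∘ (lam K ∘ ((s ⊗₁ id) ∘ ρ⁻¹-mK))
        ≈⟨ refl⟩∘⟨ pullˡ commute ⟩
      !₁ (ρ H) ∘ ((!₁ (s ⊗₁ id) ∘ lam K) ∘ ρ⁻¹-mK)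
        ≈⟨ ≈trans (refl⟩∘⟨ assoc) sym-assoc ⟩
      (!₁ (ρ H) ∘ !₁ (s ⊗₁ id)) ∘ (lam K ∘ ρ⁻¹-mK)
        ≈⟨ !-square ρ-natural ⟩∘⟨refl ⟩
      (!₁ s ∘ !₁ (ρ H)) ∘ (lam K ∘ ρ⁻¹-mK)
        ≈⟨ assoc ⟩
      !₁ s ∘ ω ∎

  hopfWithLaw : HopfInCoalg H → HopfWithLaw H
  hopfWithLaw x = record
    { hopf = hopf
    ; isHopf = isHopf
    ; lam = lawOf ω
    ; isDistLaw = record
      { natural = lawOf-natural
      ; law-μ = ∇-coalg⇒law-μ ∇-coalg
      ; law-η = u-coalg⇒law-η u-coalg
      ; law-δ = lawOf-δ coalg-coassoc
      ; law-ε = lawOf-ε coalg-counit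
      ; law-m = Δ-coalg⇒law-m Δ-coalg
      ; law-mK = ẽ-coalg⇒law-mK ẽ-coalg
      }
    ; lam-α = lawOf-associative
    ; lam-S = coalg-endo⇒lawOf-commute S-coalg
    }
    where
      open HopfInCoalg x
      open IsCoalgebra isCoalgebra
      open LawOf ω

  hopfInCoalg : HopfWithLaw H → HopfInCoalg H
  hopfInCoalg y = record
    { ω = ω
    ; isCoalgebra = record
      { coalg-counit = law-ε⇒counit law-ε
      ; coalg-coassoc = law-δ⇒coassoc natural law-δ
      }
    ; hopf = hopf
    ; isHopf = isHopf
    ; ∇-coalg = law-μ⇒∇-coalg law-μ-lawOf
    ; u-coalg = law-η⇒u-coalg law-η-lawOf
    ; Δ-coalg = law-m⇒Δ-coalg law-m-lawOf
    ; ẽ-coalg = law-mK⇒ẽ-coalg law-mK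
    ; S-coalg = law-commute⇒coalg-endo lam-S
    }
    where
      open HopfWithLaw y
      open IsSymMonMixedDistLaw isDistLaw
      open TMonad hopf
      open CoactionOf lam
      open LawOf ω

      lam≈lawOf : ∀ X → lam X ≈ lawOf ω X
      lam≈lawOf = lawOf-coactionOf natural lam-α

      law-μ-lawOf : lawOf ω K ∘ μ (!₀ K) ≈ !₁ (μ K) ∘ (lawOf ω (T₀ K) ∘ T₁ (lawOf ω K))
      law-μ-lawOf = ≈trans (≈sym (lam≈lawOf K) ⟩∘⟨refl)
        (≈trans law-μ (refl⟩∘⟨ (lam≈lawOf _ ⟩∘⟨ id⊗-resp-≈ (lam≈lawOf K))))

      law-η-lawOf : lawOf ω K ∘ η (!₀ K) ≈ !₁ (η K)
      law-η-lawOf = ≈trans (≈sym (lam≈lawOf K) ⟩∘⟨refl) law-η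

      law-m-lawOf : !₁ (n K K) ∘ (lawOf ω (K ⊗₀ K) ∘ T₁ (m K K))
                      ≈ m (T₀ K) (T₀ K) ∘ ((lawOf ω K ⊗₁ lawOf ω K) ∘ n (!₀ K) (!₀ K))
      law-m-lawOf = ≈trans (refl⟩∘⟨ (≈sym (lam≈lawOf _) ⟩∘⟨refl))
        (≈trans law-m (refl⟩∘⟨ (⊗-resp-≈ (lam≈lawOf K) (lam≈lawOf K) ⟩∘⟨refl)))

  hopfWithLaw-cong : ∀ {x y} → x ≈₁ y → hopfWithLaw x ≈₂ hopfWithLaw y
  hopfWithLaw-cong p = record { hopf≈ = _≈₁_.hopf≈ p ; lam≈ = λ _ → lawOf-resp-≈ (_≈₁_.ω≈ p) }

  hopfInCoalg-cong : ∀ {x y} → x ≈₂ y → hopfInCoalg x ≈₁ hopfInCoalg y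
  hopfInCoalg-cong p = record { ω≈ = coactionOf-resp-≈ (_≈₂_.lam≈ p) ; hopf≈ = _≈₂_.hopf≈ p }

  hopfWithLaw-hopfInCoalg : ∀ {x y} → y ≈₁ hopfInCoalg x → hopfWithLaw y ≈₂ x
  hopfWithLaw-hopfInCoalg {x} p = record
    { hopf≈ = _≈₁_.hopf≈ p
    ; lam≈ = λ X → ≈trans (lawOf-resp-≈ (_≈₁_.ω≈ p)) (≈sym (lawOf-coactionOf natural lam-α X))
    }
    where
      open HopfWithLaw x
      open IsSymMonMixedDistLaw isDistLaw

  hopfInCoalg-hopfWithLaw : ∀ {x y} → y ≈₂ hopfWithLaw x → hopfInCoalg y ≈₁ x
  hopfInCoalg-hopfWithLaw p = record
    { ω≈ = ≈trans (coactionOf-resp-≈ (_≈₂_.lam≈ p)) coactionOf-lawOf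
    ; hopf≈ = _≈₂_.hopf≈ p
    }

proposition5p6 : ∀ {o h e} (𝕏 : SymMonCat o h e) (C : SymMonComonad 𝕏) (H : SymMonCat.Obj 𝕏) →
    Inverse (Structures.HopfInCoalg-setoid 𝕏 C H) (Structures.HopfWithLaw-setoid 𝕏 C H)
proposition5p6 𝕏 C H = record
  { to = hopfWithLaw
  ; from = hopfInCoalg
  ; to-cong = hopfWithLaw-cong
  ; from-cong = hopfInCoalg-cong
  -- x and y are passed explicitly: otherwise Agda unifies hopfInCoalg x with a metavariable by
  -- unfolding the whole record, which takes minutes.
  ; inverse = (λ {x} {y} → hopfWithLaw-hopfInCoalg {x} {y}) , (λ {x} {y} → hopfInCoalg-hopfWithLaw {x} {y})
  }
  where open Correspondence 𝕏 C H
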